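{- Let $M\models T_{\mathrm{MSO(Fin)}}$ be infinite. Then for each $d\in\mathbb{N}_{>0}$ there is exactly one $h$ with $0<h\le d$ such that $M\models\rho_{d,h}$.
   Context: Let $\mathcal{L}=\{\subseteq,\bot,\mathrm{At},\lhd\}$ be the first-order language with binary relation symbols $\subseteq,\lhd$, a constant $\bot$ and a unary relation symbol $\mathrm{At}$. Lowercase variables range over atoms; $X(x)$ abbreviates $x\subseteq X$. $T_{\mathrm{base}}$ states: $\subseteq$ is an atomic Boolean algebra order (one-element algebra allowed); $\lhd$ linearly orders the atoms; $\bot$ is least; $\mathrm{At}$ holds exactly of atoms; $\forall X\forall Y(X\lhd Y\leftrightarrow\exists x\exists y(X(x)\wedge Y(y)\wedge x\lhd y))$; and for every $\mathcal{L}$-formula $\eta(x;\bar Y)$, $\forall\bar Y\exists X\forall x(X(x)\leftrightarrow\eta(x;\bar Y))$. $T_{\mathrm{MSO(Fin)}}$ is $T_{\mathrm{base}}$ plus: the order on atoms is discrete with endpoints, and every $X\neq\bot$ contains a $\lhd$-least atom; $0,0^*$ denote the least and greatest atoms. For $d\ge1$ and $1\le h\le d$, $\rho_{d,h}$ is the sentence saying: there exist non-bottom elements $A_1,\dots,A_d$ partitioning the set of atoms such that $A_1(0)$; for every atom $a\neq0^*$ and every $1\le i\le d$, $A_i(a)$ implies $A_{i'}(a')$ where $a'$ is the immediate successor of $a$ and $i'=i+1$ if $i<d$, $i'=1$ if $i=d$; and $A_h(0^*)$. -}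

module Defs where

open import Data.Nat using (ℕ; zero; suc)
open import Data.Nat.DivMod using (_mod_)
open import Data.Fin using (Fin; toℕ)
open import Data.Product using (Σ; _×_; _,_)
open import Data.Sum using (_⊎_)
open import Data.Empty using (⊥)
open import Relation.Nullary using (¬_)
open import Relation.Binary.PropositionalEquality using (_≡_; _≢_)
open import Data.Vec.Functional using (_∷_)

record LStructure : Set₁ where
  field
    Carrier : Set
    _⊆_     : Carrier → Carrier → Set
    bot     : Carrier
    At      : Carrier → Set
    _◁_     : Carrier → Carrier → Set

data Term (n : ℕ) : Set where
  var  : Fin n → Term n
  botT : Term n

data Formula (n : ℕ) : Set where
  _⊆ᶠ_ : Term n → Term n → Formula n
  _◁ᶠ_ : Term n → Term n → Formula n
  atᶠ  : Term n → Formula n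
  _≐_  : Term n → Term n → Formula n
  ⊥ᶠ   : Formula n
  _⇒ᶠ_ : Formula n → Formula n → Formula n
  _∧ᶠ_ : Formula n → Formula n → Formula n
  _∨ᶠ_ : Formula n → Formula n → Formula n
  ∀ᶠ   : Formula (suc n) → Formula n
  ∃ᶠ   : Formula (suc n) → Formula n

module _ (M : LStructure) where
  open LStructure M

  evalT : ∀ {n} → (Fin n → Carrier) → Term n → Carrier
  evalT ρ (var i) = ρ i
  evalT ρ botT    = bot

  Sat : ∀ {n} → (Fin n → Carrier) → Formula n → Set
  Sat ρ (s ⊆ᶠ t) = evalT ρ s ⊆ evalT ρ t
  Sat ρ (s ◁ᶠ t) = evalT ρ s ◁ evalT ρ t
  Sat ρ (atᶠ t)  = At (evalT ρ t)
  Sat ρ (s ≐ t)  = evalT ρ s ≡ evalT ρ t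
  Sat ρ ⊥ᶠ       = ⊥
  Sat ρ (φ ⇒ᶠ ψ) = Sat ρ φ → Sat ρ ψ
  Sat ρ (φ ∧ᶠ ψ) = Sat ρ φ × Sat ρ ψ
  Sat ρ (φ ∨ᶠ ψ) = Sat ρ φ ⊎ Sat ρ ψ
  Sat ρ (∀ᶠ φ)   = (a : Carrier) → Sat (a ∷ ρ) φ
  Sat ρ (∃ᶠ φ)   = Σ Carrier λ a → Sat (a ∷ ρ) φ

module Axioms (M : LStructure) where
  open LStructure M

  IsAtom : Carrier → Set
  IsAtom x = x ≢ bot × ((y : Carrier) → y ⊆ x → y ≡ bot ⊎ y ≡ x)

  IsLUB : Carrier → Carrier → Carrier → Set
  IsLUB a b c = a ⊆ c × b ⊆ c × ((e : Carrier) → a ⊆ e → b ⊆ e → c ⊆ e)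

  IsGLB : Carrier → Carrier → Carrier → Set
  IsGLB a b c = c ⊆ a × c ⊆ b × ((e : Carrier) → e ⊆ a → e ⊆ b → e ⊆ c)

  IsTop : Carrier → Set
  IsTop t = (a : Carrier) → a ⊆ t

  -- ⊆ is the order of an atomic Boolean algebra (one-element allowed),
  -- with ⊥ least
  record AtomicBooleanOrder : Set where
    field
      refl⊆    : (a : Carrier) → a ⊆ a
      trans⊆   : (a b c : Carrier) → a ⊆ b → b ⊆ c → a ⊆ c
      antisym⊆ : (a b : Carrier) → a ⊆ b → b ⊆ a → a ≡ b
      bot-least : (a : Carrier) → bot ⊆ a
      top      : Σ Carrier IsTop
      lub      : (a b : Carrier) → Σ Carrier (IsLUB a b)
      glb      : (a b : Carrier) → Σ Carrier (IsGLB a b)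
      -- distributivity: a ∧ (b ∨ c) = (a ∧ b) ∨ (a ∧ c)
      distrib  : (a b c j m m₁ m₂ : Carrier) → IsLUB b c j → IsGLB a j m →
                 IsGLB a b m₁ → IsGLB a c m₂ → IsLUB m₁ m₂ m
      compl    : (a : Carrier) → Σ Carrier λ a' →
                 ((t : Carrier) → IsTop t → IsLUB a a' t) × IsGLB a a' bot
      atomic   : (a : Carrier) → a ≢ bot → Σ Carrier λ x → IsAtom x × x ⊆ a

  record LinearOnAtoms : Set where
    field
      irrefl◁ : (x : Carrier) → At x → ¬ (x ◁ x)
      trans◁  : (x y z : Carrier) → At x → At y → At z → x ◁ y → y ◁ z → x ◁ z
      total◁  : (x y : Carrier) → At x → At y → x ◁ y ⊎ (x ≡ y ⊎ y ◁ x)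

  -- comprehension instance for η(x ; Y₁ … Yₖ): variable 0 is x
  Comprehension : Set
  Comprehension = (k : ℕ) (η : Formula (suc k)) (Y : Fin k → Carrier) →
    Σ Carrier λ X → (x : Carrier) → At x →
      (x ⊆ X → Sat M (x ∷ Y) η) × (Sat M (x ∷ Y) η → x ⊆ X)

  record Tbase : Set where
    field
      boolean  : AtomicBooleanOrder
      at-atoms : (x : Carrier) → (At x → IsAtom x) × (IsAtom x → At x)
      linear   : LinearOnAtoms
      lift◁    : (X Y : Carrier) →
        (X ◁ Y → Σ Carrier λ x → Σ Carrier λ y → At x × At y × x ⊆ X × y ⊆ Y × x ◁ y) ×
        ((Σ Carrier λ x → Σ Carrier λ y → At x × At y × x ⊆ X × y ⊆ Y × x ◁ y) → X ◁ Y)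
      comprehension : Comprehension

  IsLeastAtom : Carrier → Set
  IsLeastAtom z = At z × ((x : Carrier) → At x → x ≢ z → z ◁ x)

  IsGreatestAtom : Carrier → Set
  IsGreatestAtom z = At z × ((x : Carrier) → At x → x ≢ z → x ◁ z)

  IsSucc : Carrier → Carrier → Set
  IsSucc a b = At a × At b × a ◁ b ×
    ((c : Carrier) → At c → ¬ (a ◁ c × c ◁ b))

  record TMSOFin : Set where
    field
      base        : Tbase
      has-least   : Σ Carrier IsLeastAtom
      has-greatest : Σ Carrier IsGreatestAtom
      succ-exists : (a : Carrier) → At a → ¬ IsGreatestAtom a → Σ Carrier (IsSucc a)
      pred-exists : (b : Carrier) → At b → ¬ IsLeastAtom b → Σ Carrier λ a → IsSucc a b
      least-in    : (X : Carrier) → X ≢ bot → Σ Carrier λ x →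
        At x × x ⊆ X × ((y : Carrier) → At y → y ⊆ X → y ≢ x → x ◁ y)

  Infinite : Set
  Infinite = ¬ (Σ ℕ λ n → Σ (Fin n → Carrier) λ f → (c : Carrier) → Σ (Fin n) λ i → f i ≡ c)

  -- cyclic successor on indices: i ↦ i+1 mod d (indices 0..d-1 stand for 1..d)
  next : ∀ {d} → Fin d → Fin d
  next {suc k} i = suc (toℕ i) mod suc k

  -- M ⊨ ρ_{d,h}, with h : Fin d standing for h = toℕ h + 1
  ρ : (d : ℕ) → Fin d → Set
  ρ zero ()
  ρ (suc k) h = Σ (Fin (suc k) → Carrier) λ A →
      ((i : Fin (suc k)) → A i ≢ bot)
    × ((a : Carrier) → At a → Σ (Fin (suc k)) λ i → a ⊆ A i)
    × ((a : Carrier) → At a → (i j : Fin (suc k)) → a ⊆ A i → a ⊆ A j → i ≡ j)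
    × ((z : Carrier) → IsLeastAtom z → z ⊆ A Data.Fin.zero)
    × ((a b : Carrier) → ¬ IsGreatestAtom a → IsSucc a b → (i : Fin (suc k)) →
         a ⊆ A i → b ⊆ A (next i))
    × ((z : Carrier) → IsGreatestAtom z → z ⊆ A h)

LEM : Set₁
LEM = (P : Set) → P ⊎ ¬ P

module Submission where

-- Comprehension gives induction along the atoms: if a definable set of atoms
-- contains no least atom and every atom in it has its predecessor in it, it is
-- empty, by looking at its least element.  Quantifying over the d colour
-- classes, the set of atoms x up to which no cyclic d-colouring starting at 0
-- exists is definable, and the induction shows it is empty; the colouring up to
-- 0* witnesses ρ_{d,h} with h the colour of 0*.  The same induction shows that
-- two witnesses of ρ_{d,h} and ρ_{d,h'} have the same colour classes, so h = h'.
-- Infinity is needed only for the classes to be non-empty: if one of 0, 0 + 1,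
-- ..., 0 + (d - 1) were 0*, the atoms would be finitely many, and every element
-- is the join of the atoms below it.

open import Defs
open import Data.Nat using (ℕ; zero; suc; _+_; _<_; _^_; _%_; s≤s; s≤s⁻¹) renaming (_≟_ to _≟ℕ_)
open import Data.Nat.Properties using (≤∧≢⇒<)
open import Data.Nat.DivMod using (_mod_; m%n<n; m%n%n≡m%n; %-distribˡ-+; m<n⇒m%n≡m)
open import Data.Fin using (Fin; zero; suc; toℕ; fromℕ<; _↑ˡ_; _↑ʳ_; _≟_)
open import Data.Fin.Base using (finToFun; funToFin)
open import Data.Fin.Properties
  using (toℕ-fromℕ<; toℕ<n; fromℕ<-cong; fromℕ<-toℕ; finToFun-funToFin)
open import Data.Product using (Σ; _×_; _,_; proj₁; proj₂)
open import Data.Sum using (_⊎_; inj₁; inj₂)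
import Data.Sum as Sum
open import Data.Empty using (⊥-elim)
open import Data.Vec.Functional using (_∷_; [])
open import Function using (_∘_; _∘₂_; id)
open import Relation.Nullary using (¬_; Dec; yes; no)
open import Relation.Binary.PropositionalEquality
  using (_≡_; _≢_; refl; sym; trans; cong; subst; subst₂; module ≡-Reasoning)

⊤ᶠ : ∀ {n} → Formula n
⊤ᶠ = ⊥ᶠ ⇒ᶠ ⊥ᶠ

decᶠ : ∀ {n} {P : Set} → Dec P → Formula n
decᶠ (yes _) = ⊤ᶠ
decᶠ (no _)  = ⊥ᶠ

⋁ : ∀ {k n} → (Fin k → Formula n) → Formula n
⋁ {zero}  φ = ⊥ᶠ
⋁ {suc k} φ = φ zero ∨ᶠ ⋁ (φ ∘ suc)

⋀ : ∀ {k n} → (Fin k → Formula n) → Formula n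
⋀ {zero}  φ = ⊤ᶠ
⋀ {suc k} φ = φ zero ∧ᶠ ⋀ (φ ∘ suc)

∃ⁿ : ∀ k {n} → Formula (k + n) → Formula n
∃ⁿ zero    φ = φ
∃ⁿ (suc k) φ = ∃ⁿ k (∃ᶠ φ)

isSuccᶠ : ∀ {n} → Fin n → Fin n → Formula n
isSuccᶠ a b = atᶠ (var a) ∧ᶠ (atᶠ (var b) ∧ᶠ ((var a ◁ᶠ var b) ∧ᶠ
  ∀ᶠ (atᶠ (var zero) ⇒ᶠ (((var (suc a) ◁ᶠ var zero) ∧ᶠ (var zero ◁ᶠ var (suc b))) ⇒ᶠ ⊥ᶠ))))

module Satisfaction (M : LStructure) where
  open LStructure M using (Carrier)

  -- B zero is the variable bound innermost by ∃ⁿ.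
  _++ᴱ_ : ∀ {k n} → (Fin k → Carrier) → (Fin n → Carrier) → Fin (k + n) → Carrier
  _++ᴱ_ {zero}  B ρ = ρ
  _++ᴱ_ {suc k} B ρ = B zero ∷ ((B ∘ suc) ++ᴱ ρ)

  ++ᴱ-lookupˡ : ∀ {k n} (B : Fin k → Carrier) (ρ : Fin n → Carrier) (i : Fin k) →
                (B ++ᴱ ρ) (i ↑ˡ n) ≡ B i
  ++ᴱ-lookupˡ B ρ zero    = refl
  ++ᴱ-lookupˡ B ρ (suc i) = ++ᴱ-lookupˡ (B ∘ suc) ρ i

  ++ᴱ-lookupʳ : ∀ k {n} (B : Fin k → Carrier) (ρ : Fin n → Carrier) (i : Fin n) →
                (B ++ᴱ ρ) (k ↑ʳ i) ≡ ρ i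
  ++ᴱ-lookupʳ zero    B ρ i = refl
  ++ᴱ-lookupʳ (suc k) B ρ i = ++ᴱ-lookupʳ k (B ∘ suc) ρ i

  module _ {n} {ρ : Fin n → Carrier} where

    decᶠ⁺ : ∀ {P : Set} (p? : Dec P) → P → Sat M ρ (decᶠ p?)
    decᶠ⁺ (yes _) _ = id
    decᶠ⁺ (no ¬p) p = ¬p p

    decᶠ⁻ : ∀ {P : Set} (p? : Dec P) → Sat M ρ (decᶠ p?) → P
    decᶠ⁻ (yes p) _ = p
    decᶠ⁻ (no _)  ()

    ⋁⁺ : ∀ {k} (φ : Fin k → Formula n) (i : Fin k) → Sat M ρ (φ i) → Sat M ρ (⋁ φ)
    ⋁⁺ φ zero    s = inj₁ s
    ⋁⁺ φ (suc i) s = inj₂ (⋁⁺ (φ ∘ suc) i s)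

    ⋁⁻ : ∀ {k} (φ : Fin k → Formula n) → Sat M ρ (⋁ φ) → Σ (Fin k) λ i → Sat M ρ (φ i)
    ⋁⁻ {suc k} φ (inj₁ s) = zero , s
    ⋁⁻ {suc k} φ (inj₂ s) = let i , t = ⋁⁻ (φ ∘ suc) s in suc i , t

    ⋀⁺ : ∀ {k} (φ : Fin k → Formula n) → (∀ i → Sat M ρ (φ i)) → Sat M ρ (⋀ φ)
    ⋀⁺ {zero}  φ s = id
    ⋀⁺ {suc k} φ s = s zero , ⋀⁺ (φ ∘ suc) (s ∘ suc)

    ⋀⁻ : ∀ {k} (φ : Fin k → Formula n) → Sat M ρ (⋀ φ) → ∀ i → Sat M ρ (φ i)
    ⋀⁻ φ (s , _) zero    = s
    ⋀⁻ φ (_ , s) (suc i) = ⋀⁻ (φ ∘ suc) s i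

  ∃ⁿ⁺ : ∀ k {n} (ρ : Fin n → Carrier) (φ : Formula (k + n)) (B : Fin k → Carrier) →
        Sat M (B ++ᴱ ρ) φ → Sat M ρ (∃ⁿ k φ)
  ∃ⁿ⁺ zero    ρ φ B s = s
  ∃ⁿ⁺ (suc k) ρ φ B s = ∃ⁿ⁺ k ρ (∃ᶠ φ) (B ∘ suc) (B zero , s)

  ∃ⁿ⁻ : ∀ k {n} (ρ : Fin n → Carrier) (φ : Formula (k + n)) →
        Sat M ρ (∃ⁿ k φ) → Σ (Fin k → Carrier) λ B → Sat M (B ++ᴱ ρ) φ
  ∃ⁿ⁻ zero    ρ φ s = (λ ()) , s
  ∃ⁿ⁻ (suc k) ρ φ s = let B , a , t = ∃ⁿ⁻ k ρ (∃ᶠ φ) s in (a ∷ B) , t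

mod-toℕ : ∀ {k} (i : Fin (suc k)) → toℕ i mod suc k ≡ i
mod-toℕ {k} i = trans (fromℕ<-cong _ _ (m<n⇒m%n≡m (toℕ<n i)) _ (toℕ<n i)) (fromℕ<-toℕ i _)

module MSOFin (lem : LEM) (M : LStructure) (T : Axioms.TMSOFin M) where
  open LStructure M renaming (Carrier to C)
  open Axioms M
  open TMSOFin T
  open Tbase base
  open AtomicBooleanOrder boolean
  open LinearOnAtoms linear
  open Satisfaction M

  next-mod : ∀ {k} n → next (n mod suc k) ≡ suc n mod suc k
  next-mod {k} n = fromℕ<-cong _ _ (begin
      suc (toℕ (n mod d)) % d   ≡⟨ cong (λ r → suc r % d) (toℕ-fromℕ< (m%n<n n d)) ⟩
      (1 + n % d) % d           ≡⟨ %-distribˡ-+ 1 (n % d) d ⟩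
      (1 % d + n % d % d) % d   ≡⟨ cong (λ r → (1 % d + r) % d) (m%n%n≡m%n n d) ⟩
      (1 % d + n % d) % d       ≡⟨ %-distribˡ-+ 1 n d ⟨
      suc n % d                 ∎) _ _
    where
    open ≡-Reasoning
    d = suc k

  atom≢bot : ∀ {a} → At a → a ≢ bot
  atom≢bot {a} at = proj₁ (proj₁ (at-atoms a) at)

  atom⊈bot : ∀ {a} → At a → ¬ a ⊆ bot
  atom⊈bot {a} at a⊆bot = atom≢bot at (antisym⊆ a bot a⊆bot (bot-least a))

  ◁-asym : ∀ {a b} → At a → At b → a ◁ b → ¬ b ◁ a
  ◁-asym {a} {b} at bt a◁b b◁a = irrefl◁ a at (trans◁ a b a at bt at a◁b b◁a)

  ◁⇒≢ : ∀ {a b} → At a → a ◁ b → a ≢ b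
  ◁⇒≢ {a} at a◁a refl = irrefl◁ a at a◁a

  ¬◁least : ∀ {z a} → IsLeastAtom z → At a → ¬ a ◁ z
  ¬◁least (zt , least) at a◁z = ◁-asym at zt a◁z (least _ at (◁⇒≢ at a◁z))

  ¬greatest◁ : ∀ {g a} → IsGreatestAtom g → At a → ¬ g ◁ a
  ¬greatest◁ (gt , greatest) at g◁a =
    ◁-asym gt at g◁a (greatest _ at (λ a≡g → ◁⇒≢ gt g◁a (sym a≡g)))

  least-unique : ∀ {z z'} → IsLeastAtom z → IsLeastAtom z' → z ≡ z'
  least-unique zL@(zt , _) z'L@(z't , _) with total◁ _ _ zt z't
  ... | inj₁ z◁z'        = ⊥-elim (¬◁least z'L zt z◁z')
  ... | inj₂ (inj₁ z≡z') = z≡z'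
  ... | inj₂ (inj₂ z'◁z) = ⊥-elim (¬◁least zL z't z'◁z)

  greatest-unique : ∀ {g g'} → IsGreatestAtom g → IsGreatestAtom g' → g ≡ g'
  greatest-unique gG@(gt , _) g'G@(g't , _) with total◁ _ _ gt g't
  ... | inj₁ g◁g'        = ⊥-elim (¬greatest◁ gG g't g◁g')
  ... | inj₂ (inj₁ g≡g') = g≡g'
  ... | inj₂ (inj₂ g'◁g) = ⊥-elim (¬greatest◁ g'G gt g'◁g)

  _≼_ : C → C → Set
  a ≼ b = a ◁ b ⊎ a ≡ b

  ≼greatest : ∀ {g a} → IsGreatestAtom g → At a → a ≼ g
  ≼greatest gG@(gt , _) at with total◁ _ _ at gt
  ... | inj₁ a◁g        = inj₁ a◁g
  ... | inj₂ (inj₁ a≡g) = inj₂ a≡g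
  ... | inj₂ (inj₂ g◁a) = ⊥-elim (¬greatest◁ gG at g◁a)

  ◁greatest : ∀ {g a} → IsGreatestAtom g → At a → ¬ IsGreatestAtom a → a ◁ g
  ◁greatest gG@(_ , greatest) at ¬aG =
    greatest _ at (λ a≡g → ¬aG (subst IsGreatestAtom (sym a≡g) gG))

  succ-unique : ∀ {a b b'} → IsSucc a b → IsSucc a b' → b ≡ b'
  succ-unique (_ , bt , a◁b , between) (_ , b't , a◁b' , between') with total◁ _ _ bt b't
  ... | inj₁ b◁b'        = ⊥-elim (between' _ bt (a◁b , b◁b'))
  ... | inj₂ (inj₁ b≡b') = b≡b'
  ... | inj₂ (inj₂ b'◁b) = ⊥-elim (between _ b't (a◁b' , b'◁b))

  succ⇒¬greatest : ∀ {a b} → IsSucc a b → ¬ IsGreatestAtom a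
  succ⇒¬greatest (_ , bt , a◁b , _) aG = ¬greatest◁ aG bt a◁b

  succ⇒¬least : ∀ {a b} → IsSucc a b → ¬ IsLeastAtom b
  succ⇒¬least (at , _ , a◁b , _) bL = ¬◁least bL at a◁b

  ◁succ : ∀ {a b c} → IsSucc a b → At c → c ◁ b → c ≼ a
  ◁succ (at , _ , _ , between) ct c◁b with total◁ _ _ ct at
  ... | inj₁ c◁a        = inj₁ c◁a
  ... | inj₂ (inj₁ c≡a) = inj₂ c≡a
  ... | inj₂ (inj₂ a◁c) = ⊥-elim (between _ ct (a◁c , c◁b))

  atomless⇒bot : ∀ {a} → (∀ y → At y → ¬ y ⊆ a) → a ≡ bot
  atomless⇒bot {a} atomless with lem (a ≡ bot)
  ... | inj₁ a≡bot = a≡bot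
  ... | inj₂ a≢bot =
    let y , yA , y⊆a = atomic a a≢bot in ⊥-elim (atomless y (proj₂ (at-atoms y) yA) y⊆a)

  -- X ⊆ X ∧ (Y ∨ Yᶜ) = (X ∧ Y) ∨ (X ∧ Yᶜ), and X ∧ Yᶜ has no atoms.
  ⊆-by-atoms : ∀ {X Y} → (∀ y → At y → y ⊆ X → y ⊆ Y) → X ⊆ Y
  ⊆-by-atoms {X} {Y} atoms⊆ =
    trans⊆ X X∧Y Y (proj₂ (proj₂ X∧Y∨bot) X∧Y (refl⊆ X∧Y) (bot-least X∧Y))
                   (proj₁ (proj₂ X∧Y-glb))
    where
    t = proj₁ top
    Yᶜ = proj₁ (compl Y)
    Y∨Yᶜ : IsLUB Y Yᶜ t
    Y∨Yᶜ = proj₁ (proj₂ (compl Y)) t (proj₂ top)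
    Y∧Yᶜ : IsGLB Y Yᶜ bot
    Y∧Yᶜ = proj₂ (proj₂ (compl Y))
    X∧Y = proj₁ (glb X Y)
    X∧Y-glb = proj₂ (glb X Y)
    X∧Yᶜ = proj₁ (glb X Yᶜ)
    X∧Yᶜ-glb = proj₂ (glb X Yᶜ)
    X∧Yᶜ≡bot : X∧Yᶜ ≡ bot
    X∧Yᶜ≡bot = atomless⇒bot λ y yt y⊆ →
      let y⊆Y = atoms⊆ y yt (trans⊆ y X∧Yᶜ X y⊆ (proj₁ X∧Yᶜ-glb))
          y⊆Yᶜ = trans⊆ y X∧Yᶜ Yᶜ y⊆ (proj₁ (proj₂ X∧Yᶜ-glb))
      in atom⊈bot yt (proj₂ (proj₂ Y∧Yᶜ) y y⊆Y y⊆Yᶜ)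
    X∧Y∨bot : IsLUB X∧Y bot X
    X∧Y∨bot = distrib X Y Yᶜ t X X∧Y bot Y∨Yᶜ (refl⊆ X , proj₂ top X , λ _ e⊆X _ → e⊆X)
      X∧Y-glb (subst (IsGLB X Yᶜ) X∧Yᶜ≡bot X∧Yᶜ-glb)

  atoms-ext : ∀ {X Y} → (∀ y → At y → y ⊆ X → y ⊆ Y) → (∀ y → At y → y ⊆ Y → y ⊆ X) → X ≡ Y
  atoms-ext {X} {Y} X⊆Y Y⊆X = antisym⊆ X Y (⊆-by-atoms X⊆Y) (⊆-by-atoms Y⊆X)

  Defines : C → (C → Set) → Set
  Defines X Q = ∀ a → At a → (a ⊆ X → Q a) × (Q a → a ⊆ X)

  Definable : (C → Set) → Set
  Definable Q = Σ C λ X → Defines X Q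

  definable-resp : ∀ {P Q : C → Set} → (∀ a → At a → P a → Q a) → (∀ a → At a → Q a → P a) →
                   Definable P → Definable Q
  definable-resp P⇒Q Q⇒P (X , def) =
    X , λ a at → P⇒Q a at ∘ proj₁ (def a at) , proj₂ (def a at) ∘ Q⇒P a at

  definable-⊆ : ∀ X → Definable (_⊆ X)
  definable-⊆ X = X , λ _ _ → id , id

  definable-≡ : ∀ y → Definable (_≡ y)
  definable-≡ y = comprehension 1 (var zero ≐ var (suc zero)) (y ∷ [])

  definable-dec : ∀ {P : Set} → Dec P → Definable (λ _ → P)
  definable-dec (yes p) = proj₁ top , λ a _ → (λ _ → p) , (λ _ → proj₂ top a)
  definable-dec (no ¬p) = bot , λ _ at → ⊥-elim ∘ atom⊈bot at , ⊥-elim ∘ ¬p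

  definable-¬ : ∀ {P} → Definable P → Definable (λ a → ¬ P a)
  definable-¬ (X , def) = definable-resp
    (λ a at a⊈X p → a⊈X (proj₂ (def a at) p)) (λ a at ¬p a⊆X → ¬p (proj₁ (def a at) a⊆X))
    (comprehension 1 ((var zero ⊆ᶠ var (suc zero)) ⇒ᶠ ⊥ᶠ) (X ∷ []))

  definable-× : ∀ {P Q} → Definable P → Definable Q → Definable (λ a → P a × Q a)
  definable-× (X , defP) (Y , defQ) = definable-resp
    (λ a at (a⊆X , a⊆Y) → proj₁ (defP a at) a⊆X , proj₁ (defQ a at) a⊆Y)
    (λ a at (p , q) → proj₂ (defP a at) p , proj₂ (defQ a at) q)
    (comprehension 2 ((var zero ⊆ᶠ var (suc zero)) ∧ᶠ (var zero ⊆ᶠ var (suc (suc zero))))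
                     (X ∷ Y ∷ []))

  definable-⊎ : ∀ {P Q} → Definable P → Definable Q → Definable (λ a → P a ⊎ Q a)
  definable-⊎ (X , defP) (Y , defQ) = definable-resp
    (λ a at → Sum.map (proj₁ (defP a at)) (proj₁ (defQ a at)))
    (λ a at → Sum.map (proj₂ (defP a at)) (proj₂ (defQ a at)))
    (comprehension 2 ((var zero ⊆ᶠ var (suc zero)) ∨ᶠ (var zero ⊆ᶠ var (suc (suc zero))))
                     (X ∷ Y ∷ []))

  definable-Σ : ∀ {k} {Q : Fin k → C → Set} → (∀ i → Definable (Q i)) →
                Definable (λ a → Σ (Fin k) λ i → Q i a)
  definable-Σ {k} defs = definable-resp
    (λ a at s → let i , a⊆ = ⋁⁻ ⊆X s in i , proj₁ (proj₂ (defs i) a at) a⊆)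
    (λ a at (i , q) → ⋁⁺ ⊆X i (proj₂ (proj₂ (defs i) a at) q))
    (comprehension k (⋁ ⊆X) (proj₁ ∘ defs))
    where
    ⊆X : Fin k → Formula (suc k)
    ⊆X i = var zero ⊆ᶠ var (suc i)

  -- A least counterexample would have a predecessor, which is a smaller counterexample.
  definable-induction : ∀ {Bad} → Definable Bad →
    (∀ z → IsLeastAtom z → ¬ Bad z) → (∀ a b → IsSucc a b → Bad b → Bad a) →
    ∀ a → At a → ¬ Bad a
  definable-induction (X , def) base step a at bad
    with least-in X (λ X≡bot → atom⊈bot at (subst (a ⊆_) X≡bot (proj₂ (def a at) bad)))
  ... | w , wt , w⊆X , w-least with lem (IsLeastAtom w)
  ...   | inj₁ wL = base w wL (proj₁ (def w wt) w⊆X)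
  ...   | inj₂ ¬wL =
    let p , p◁w@(pt , _ , p◁w' , _) = pred-exists w wt ¬wL
        p⊆X = proj₂ (def p pt) (step p w p◁w (proj₁ (def w wt) w⊆X))
    in ◁-asym pt wt p◁w' (w-least p pt p⊆X (◁⇒≢ pt p◁w'))

  Finite : Set
  Finite = Σ ℕ λ n → Σ (Fin n → C) λ f → (c : C) → Σ (Fin n) λ i → f i ≡ c

  -- Each element is the join of the listed atoms below it, so 2 ^ K elements suffice.
  finite-if-atoms-listed : ∀ {K} (a : Fin K → C) → (∀ y → At y → Σ (Fin K) λ j → y ≡ a j) → Finite
  finite-if-atoms-listed {K} a listed = 2 ^ K , (λ i → proj₁ (span (finToFun i))) , onto
    where
    span : (s : Fin K → Fin 2) → Definable (λ y → Σ (Fin K) λ j → s j ≡ suc zero × y ≡ a j)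
    span s = definable-Σ λ j → definable-× (definable-dec (s j ≟ suc zero)) (definable-≡ (a j))
    indicator : ∀ {P : Set} → P ⊎ ¬ P → Fin 2
    indicator (inj₁ _) = suc zero
    indicator (inj₂ _) = zero
    onto : (c : C) → Σ (Fin (2 ^ K)) λ i → proj₁ (span (finToFun i)) ≡ c
    onto c = funToFin below-c , atoms-ext span⊆c c⊆span
      where
      below-c : Fin K → Fin 2
      below-c j = indicator (lem (a j ⊆ c))
      s = finToFun (funToFin below-c)
      def = proj₂ (span s)
      s-sound : ∀ j → s j ≡ suc zero → a j ⊆ c
      s-sound j sj≡1 with lem (a j ⊆ c) | trans (sym (finToFun-funToFin below-c j)) sj≡1
      ... | inj₁ aj⊆c | _ = aj⊆c
      ... | inj₂ _    | ()
      s-complete : ∀ j → a j ⊆ c → s j ≡ suc zero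
      s-complete j aj⊆c with lem (a j ⊆ c) | finToFun-funToFin below-c j
      ... | inj₁ _    | sj≡1 = sj≡1
      ... | inj₂ aj⊈c | _    = ⊥-elim (aj⊈c aj⊆c)
      span⊆c : ∀ y → At y → y ⊆ proj₁ (span s) → y ⊆ c
      span⊆c y yt y⊆ with proj₁ (def y yt) y⊆
      ... | j , sj≡1 , refl = s-sound j sj≡1
      c⊆span : ∀ y → At y → y ⊆ c → y ⊆ proj₁ (span s)
      c⊆span y yt y⊆c with listed y yt
      ... | j , refl = proj₂ (def y yt) (j , s-complete j y⊆c , refl)

  first last : C
  first = proj₁ has-least
  last  = proj₁ has-greatest

  first-least : IsLeastAtom first
  first-least = proj₂ has-least

  last-greatest : IsGreatestAtom last
  last-greatest = proj₂ has-greatest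

  step : C → C
  step a with lem (At a × ¬ IsGreatestAtom a)
  ... | inj₁ (at , ¬aG) = proj₁ (succ-exists a at ¬aG)
  ... | inj₂ _          = a

  step-atom : ∀ {a} → At a → At (step a)
  step-atom {a} at with lem (At a × ¬ IsGreatestAtom a)
  ... | inj₁ (at , ¬aG) = proj₁ (proj₂ (proj₂ (succ-exists a at ¬aG)))
  ... | inj₂ _          = at

  step-succ : ∀ {a} → At a → ¬ IsGreatestAtom a → IsSucc a (step a)
  step-succ {a} at ¬aG with lem (At a × ¬ IsGreatestAtom a)
  ... | inj₁ (at , ¬aG) = proj₂ (succ-exists a at ¬aG)
  ... | inj₂ ¬step      = ⊥-elim (¬step (at , ¬aG))

  chain : ℕ → C
  chain zero    = first
  chain (suc n) = step (chain n)

  chain-atom : ∀ n → At (chain n)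
  chain-atom zero    = proj₁ first-least
  chain-atom (suc n) = step-atom (chain-atom n)

  greatest-in-chain⇒finite : ∀ m → IsGreatestAtom (chain m) → Finite
  greatest-in-chain⇒finite m cmG = finite-if-atoms-listed (chain ∘ toℕ) listed
    where
    Unlisted : C → Set
    Unlisted y = ¬ Σ (Fin (suc m)) λ j → y ≡ chain (toℕ j)
    unlisted-succ : ∀ p y → IsSucc p y → Unlisted y → Unlisted p
    unlisted-succ p y p◁y y-unlisted (j , refl) with toℕ j ≟ℕ m
    ... | yes j≡m  = succ⇒¬greatest p◁y (subst (IsGreatestAtom ∘ chain) (sym j≡m) cmG)
    ... | no j≢m   = y-unlisted (fromℕ< j+1≤m , trans y≡step (cong chain (sym (toℕ-fromℕ< j+1≤m))))
      where
      j+1≤m : suc (toℕ j) < suc m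
      j+1≤m = s≤s (≤∧≢⇒< (s≤s⁻¹ (toℕ<n j)) j≢m)
      y≡step : y ≡ step (chain (toℕ j))
      y≡step = succ-unique p◁y (step-succ (chain-atom (toℕ j)) (succ⇒¬greatest p◁y))
    listed : ∀ y → At y → Σ (Fin (suc m)) λ j → y ≡ chain (toℕ j)
    listed y yt with lem (Σ (Fin (suc m)) λ j → y ≡ chain (toℕ j))
    ... | inj₁ y-listed   = y-listed
    ... | inj₂ y-unlisted = ⊥-elim (definable-induction
            (definable-¬ (definable-Σ λ j → definable-≡ (chain (toℕ j))))
            (λ z zL z-unlisted → z-unlisted (zero , sym (least-unique first-least zL)))
            unlisted-succ y yt y-unlisted)

  chain-¬greatest : Infinite → ∀ n → ¬ IsGreatestAtom (chain n)
  chain-¬greatest infinite n cnG = infinite (greatest-in-chain⇒finite n cnG)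

  chain-succ : Infinite → ∀ n → IsSucc (chain n) (chain (suc n))
  chain-succ infinite n = step-succ (chain-atom n) (chain-¬greatest infinite n)

  module Period (k : ℕ) where
    d : ℕ
    d = suc k

    record PeriodicUpTo (z x : C) (B : Fin d → C) : Set where
      field
        covers : ∀ a → At a → a ≼ x → Σ (Fin d) λ i → a ⊆ B i
        unique : ∀ a → At a → a ≼ x → ∀ i j → a ⊆ B i → a ⊆ B j → i ≡ j
        starts : z ⊆ B zero
        steps  : ∀ a b → IsSucc a b → a ◁ x → ∀ i → a ⊆ B i → b ⊆ B (next i)

    PeriodicUpTo-resp : ∀ {z x B B'} → (∀ i → B i ≡ B' i) → PeriodicUpTo z x B → PeriodicUpTo z x B'
    PeriodicUpTo-resp {B = B} {B'} B≗B' per = record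
      { covers = λ a at a≼x → let i , a⊆ = covers a at a≼x in i , to i a⊆
      ; unique = λ a at a≼x i j a⊆i a⊆j → unique a at a≼x i j (from i a⊆i) (from j a⊆j)
      ; starts = to zero starts
      ; steps  = λ a b a◁b a◁x i a⊆ → to (next i) (steps a b a◁b a◁x i (from i a⊆))
      }
      where
      open PeriodicUpTo per
      to : ∀ {a} i → a ⊆ B i → a ⊆ B' i
      to {a} i = subst (a ⊆_) (B≗B' i)
      from : ∀ {a} i → a ⊆ B' i → a ⊆ B i
      from {a} i = subst (a ⊆_) (sym (B≗B' i))

    Bᵛ : Fin d → Fin (d + 2)
    Bᵛ i = i ↑ˡ 2

    xᵛ zᵛ : Fin (d + 2)
    xᵛ = d ↑ʳ zero
    zᵛ = d ↑ʳ suc zero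

    coloured : Fin d → Formula (suc (d + 2))
    coloured i = var zero ⊆ᶠ var (suc (Bᵛ i))

    coloured-once : Fin d → Fin d → Formula (suc (d + 2))
    coloured-once i j = coloured i ⇒ᶠ (coloured j ⇒ᶠ decᶠ (i ≟ j))

    coloured-next : Fin d → Formula (suc (suc (d + 2)))
    coloured-next i =
      (var (suc zero) ⊆ᶠ var (suc (suc (Bᵛ i)))) ⇒ᶠ (var zero ⊆ᶠ var (suc (suc (Bᵛ (next i)))))

    ∀atom≼x : Formula (suc (d + 2)) → Formula (d + 2)
    ∀atom≼x φ =
      ∀ᶠ (atᶠ (var zero) ⇒ᶠ (((var zero ◁ᶠ var (suc xᵛ)) ∨ᶠ (var zero ≐ var (suc xᵛ))) ⇒ᶠ φ))

    periodicᶠ : Formula (d + 2)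
    periodicᶠ = ∀atom≼x (⋁ coloured)
             ∧ᶠ (∀atom≼x (⋀ λ i → ⋀ (coloured-once i))
             ∧ᶠ ((var zᵛ ⊆ᶠ var (Bᵛ zero))
             ∧ᶠ ∀ᶠ (∀ᶠ (isSuccᶠ (suc zero) zero
                        ⇒ᶠ ((var (suc zero) ◁ᶠ var (suc (suc xᵛ))) ⇒ᶠ ⋀ coloured-next)))))

    -- Sat unfolds isSuccᶠ and the guards of ∀atom≼x definitionally to IsSucc and _≼_.
    sat⇒periodic : (ρ : Fin (d + 2) → C) → Sat M ρ periodicᶠ → PeriodicUpTo (ρ zᵛ) (ρ xᵛ) (ρ ∘ Bᵛ)
    sat⇒periodic ρ (covers , unique , starts , steps) = record
      { covers = λ a at a≼x → ⋁⁻ coloured (covers a at a≼x)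
      ; unique = λ a at a≼x i j →
          decᶠ⁻ (i ≟ j) ∘₂ ⋀⁻ (coloured-once i) (⋀⁻ (⋀ ∘ coloured-once) (unique a at a≼x) i) j
      ; starts = starts
      ; steps  = λ a b a◁b a◁x → ⋀⁻ coloured-next (steps a b a◁b a◁x)
      }

    periodic⇒sat : (ρ : Fin (d + 2) → C) → PeriodicUpTo (ρ zᵛ) (ρ xᵛ) (ρ ∘ Bᵛ) → Sat M ρ periodicᶠ
    periodic⇒sat ρ per =
        (λ a at a≼x → let i , a⊆ = covers a at a≼x in ⋁⁺ coloured i a⊆)
      , (λ a at a≼x → ⋀⁺ (⋀ ∘ coloured-once) λ i → ⋀⁺ (coloured-once i) λ j a⊆i a⊆j →
            decᶠ⁺ (i ≟ j) (unique a at a≼x i j a⊆i a⊆j))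
      , starts
      , (λ a b a◁b a◁x → ⋀⁺ coloured-next (steps a b a◁b a◁x))
      where open PeriodicUpTo per

    definable-periodic : Definable (λ x → Σ (Fin d → C) (PeriodicUpTo first x))
    definable-periodic = definable-resp
      (λ x _ s → let B , sat = ∃ⁿ⁻ d (x ∷ first ∷ []) periodicᶠ s in
        env B x ∘ Bᵛ , subst₂ (λ z x' → PeriodicUpTo z x' (env B x ∘ Bᵛ))
                         (env-z B x) (env-x B x) (sat⇒periodic (env B x) sat))
      (λ x _ (B , per) → ∃ⁿ⁺ d (x ∷ first ∷ []) periodicᶠ B (periodic⇒sat (env B x)
        (PeriodicUpTo-resp (λ i → sym (++ᴱ-lookupˡ B _ i))
          (subst₂ (λ z x' → PeriodicUpTo z x' B) (sym (env-z B x)) (sym (env-x B x)) per))))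
      (comprehension 1 (∃ⁿ d periodicᶠ) (first ∷ []))
      where
      env : (Fin d → C) → C → Fin (d + 2) → C
      env B x = B ++ᴱ (x ∷ first ∷ [])
      env-x : ∀ B x → env B x xᵛ ≡ x
      env-x B x = ++ᴱ-lookupʳ d B (x ∷ first ∷ []) zero
      env-z : ∀ B x → env B x zᵛ ≡ first
      env-z B x = ++ᴱ-lookupʳ d B (x ∷ first ∷ []) (suc zero)

    periodic-first : Σ (Fin d → C) (PeriodicUpTo first first)
    periodic-first = B , record
      { covers = λ a at _ → zero , proj₂ (def zero a at) refl
      ; unique = λ a at _ i j a⊆i a⊆j →
          trans (proj₁ (def i a at) a⊆i) (sym (proj₁ (def j a at) a⊆j))
      ; starts = proj₂ (def zero first (proj₁ first-least)) refl
      ; steps  = λ a _ (at , _) a◁first → ⊥-elim (¬◁least first-least at a◁first)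
      }
      where
      B : Fin d → C
      B i = proj₁ (definable-dec (i ≟ zero))
      def : ∀ i → Defines (B i) (λ _ → i ≡ zero)
      def i = proj₂ (definable-dec (i ≟ zero))

    -- y takes the colour after that of its predecessor p; everything below y keeps its colour.
    periodic-step : ∀ {p y B} → IsSucc p y → PeriodicUpTo first p B →
                    Σ (Fin d → C) (PeriodicUpTo first y)
    periodic-step {p} {y} {B} p◁y@(pt , yt , p◁y' , _) per = B' , record
      { covers = covers'
      ; unique = unique'
      ; starts = proj₂ (def zero first (proj₁ first-least))
                   (inj₁ (starts , λ first≡y → succ⇒¬least p◁y (subst IsLeastAtom first≡y first-least)))
      ; steps  = steps'
      }
      where
      open PeriodicUpTo per
      j : Fin d
      j = proj₁ (covers p pt (inj₂ refl))
      p⊆j : p ⊆ B j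
      p⊆j = proj₂ (covers p pt (inj₂ refl))
      Recoloured : Fin d → C → Set
      Recoloured i a = (a ⊆ B i × a ≢ y) ⊎ (a ≡ y × i ≡ next j)
      recoloured : ∀ i → Definable (Recoloured i)
      recoloured i = definable-⊎ (definable-× (definable-⊆ (B i)) (definable-¬ (definable-≡ y)))
                                (definable-× (definable-≡ y) (definable-dec (i ≟ next j)))
      B' : Fin d → C
      B' i = proj₁ (recoloured i)
      def : ∀ i → Defines (B' i) (Recoloured i)
      def i = proj₂ (recoloured i)
      ≼p : ∀ {a} → At a → a ◁ y → a ≼ p
      ≼p at a◁y = ◁succ p◁y at a◁y
      covers' : ∀ a → At a → a ≼ y → Σ (Fin d) λ i → a ⊆ B' i
      covers' a at (inj₂ a≡y) = next j , proj₂ (def (next j) a at) (inj₂ (a≡y , refl))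
      covers' a at (inj₁ a◁y) =
        let i , a⊆i = covers a at (≼p at a◁y) in i , proj₂ (def i a at) (inj₁ (a⊆i , ◁⇒≢ at a◁y))
      unique' : ∀ a → At a → a ≼ y → ∀ i i' → a ⊆ B' i → a ⊆ B' i' → i ≡ i'
      unique' a at a≼y i i' a⊆i a⊆i' with proj₁ (def i a at) a⊆i | proj₁ (def i' a at) a⊆i'
      ... | inj₂ (_ , i≡) | inj₂ (_ , i'≡) = trans i≡ (sym i'≡)
      ... | inj₁ (_ , a≢y) | inj₂ (a≡y , _) = ⊥-elim (a≢y a≡y)
      ... | inj₂ (a≡y , _) | inj₁ (_ , a≢y) = ⊥-elim (a≢y a≡y)
      ... | inj₁ (a⊆i , a≢y) | inj₁ (a⊆i' , _) with a≼y
      ...   | inj₁ a◁y = unique a at (≼p at a◁y) i i' a⊆i a⊆i'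
      ...   | inj₂ a≡y = ⊥-elim (a≢y a≡y)
      steps' : ∀ a b → IsSucc a b → a ◁ y → ∀ i → a ⊆ B' i → b ⊆ B' (next i)
      steps' a b a◁b@(at , bt , _) a◁y i a⊆i with proj₁ (def i a at) a⊆i | ≼p at a◁y
      ... | inj₂ (a≡y , _)  | _         = ⊥-elim (◁⇒≢ at a◁y a≡y)
      ... | inj₁ (a⊆i , _)  | inj₂ refl = proj₂ (def (next i) b bt)
            (inj₂ (succ-unique a◁b p◁y , cong next (unique a at (inj₂ refl) i j a⊆i p⊆j)))
      ... | inj₁ (a⊆i , _)  | inj₁ a◁p  =
        proj₂ (def (next i) b bt) (inj₁ (steps a b a◁b a◁p i a⊆i , b≢y))
        where
        b≢y : b ≢ y
        b≢y b≡y = proj₂ (proj₂ (proj₂ a◁b)) p pt (a◁p , subst (p ◁_) (sym b≡y) p◁y')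

    periodic-exists : ∀ x → At x → Σ (Fin d → C) (PeriodicUpTo first x)
    periodic-exists x xt with lem (Σ (Fin d → C) (PeriodicUpTo first x))
    ... | inj₁ per = per
    ... | inj₂ ¬per = ⊥-elim (definable-induction (definable-¬ definable-periodic)
      (λ z zL ¬per-z → ¬per-z (subst (λ z → Σ (Fin d → C) (PeriodicUpTo first z))
                                    (least-unique first-least zL) periodic-first))
      (λ p y p◁y ¬per-y (B , per) → ¬per-y (periodic-step p◁y per))
      x xt ¬per)

    ρ-exists : Infinite → Σ (Fin d) (ρ d)
    ρ-exists infinite =
      h , A , nonempty , covers-all , unique-all , starts-least , steps-all , ends-greatest
      where
      lastt : At last
      lastt = proj₁ last-greatest
      A : Fin d → C
      A = proj₁ (periodic-exists last lastt)
      open PeriodicUpTo (proj₂ (periodic-exists last lastt))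
      h : Fin d
      h = proj₁ (covers last lastt (inj₂ refl))
      covers-all : ∀ a → At a → Σ (Fin d) λ i → a ⊆ A i
      covers-all a at = covers a at (≼greatest last-greatest at)
      unique-all : ∀ a → At a → ∀ i j → a ⊆ A i → a ⊆ A j → i ≡ j
      unique-all a at = unique a at (≼greatest last-greatest at)
      starts-least : ∀ z → IsLeastAtom z → z ⊆ A zero
      starts-least z zL = subst (_⊆ A zero) (least-unique first-least zL) starts
      steps-all : ∀ a b → ¬ IsGreatestAtom a → IsSucc a b → ∀ i → a ⊆ A i → b ⊆ A (next i)
      steps-all a b ¬aG a◁b = steps a b a◁b (◁greatest last-greatest (proj₁ a◁b) ¬aG)
      ends-greatest : ∀ z → IsGreatestAtom z → z ⊆ A h
      ends-greatest z zG =
        subst (_⊆ A h) (greatest-unique last-greatest zG) (proj₂ (covers last lastt (inj₂ refl)))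
      chain-coloured : ∀ n → chain n ⊆ A (n mod d)
      chain-coloured zero    = starts
      chain-coloured (suc n) = subst (λ i → chain (suc n) ⊆ A i) (next-mod n)
        (steps-all _ _ (chain-¬greatest infinite n) (chain-succ infinite n) _ (chain-coloured n))
      nonempty : ∀ i → A i ≢ bot
      nonempty i Ai≡bot = atom⊈bot (chain-atom (toℕ i))
        (subst (λ X → chain (toℕ i) ⊆ X) (trans (cong A (mod-toℕ i)) Ai≡bot) (chain-coloured (toℕ i)))

    ρ-⊆ : ∀ {h h'} (r : ρ d h) (r' : ρ d h') → ∀ a → At a → ∀ i → a ⊆ proj₁ r i → a ⊆ proj₁ r' i
    ρ-⊆ (A , _ , covers , unique , starts , steps , _) (A' , _ , _ , _ , starts' , steps' , _)
        a at i a⊆i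
      with lem (a ⊆ A' i)
    ... | inj₁ a⊆'i = a⊆'i
    ... | inj₂ a⊈'i = ⊥-elim (definable-induction
      (definable-Σ λ i → definable-× (definable-⊆ (A i)) (definable-¬ (definable-⊆ (A' i))))
      (λ z zL (i , z⊆i , z⊈'i) → z⊈'i (subst (λ i → z ⊆ A' i)
                                            (unique z (proj₁ zL) zero i (starts z zL) z⊆i) (starts' z zL)))
      discrepancy-pred a at (i , a⊆i , a⊈'i))
      where
      discrepancy-pred : ∀ p y → IsSucc p y → Σ (Fin d) (λ i → y ⊆ A i × ¬ y ⊆ A' i) →
                         Σ (Fin d) (λ i → p ⊆ A i × ¬ p ⊆ A' i)
      discrepancy-pred p y p◁y@(pt , yt , _) (i , y⊆i , y⊈'i) =
        let j , p⊆j = covers p pt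
            ¬pG = succ⇒¬greatest p◁y
        in j , p⊆j , λ p⊆'j → y⊈'i (subst (λ i → y ⊆ A' i)
                                     (unique y yt (next j) i (steps p y ¬pG p◁y j p⊆j) y⊆i)
                                     (steps' p y ¬pG p◁y j p⊆'j))

    ρ-unique : ∀ {h h'} → ρ d h → ρ d h' → h ≡ h'
    ρ-unique {h} {h'} r@(_ , _ , _ , _ , _ , _ , ends) r'@(_ , _ , _ , unique' , _ , _ , ends') =
      unique' last (proj₁ last-greatest) h h'
        (ρ-⊆ r r' last (proj₁ last-greatest) h (ends last last-greatest)) (ends' last last-greatest)

lemma4p6 : LEM → (M : LStructure) → Axioms.TMSOFin M → Axioms.Infinite M →
    (d : ℕ) → 0 < d →
    Σ (Fin d) λ h → Axioms.ρ M d h × ((h' : Fin d) → Axioms.ρ M d h' → h' ≡ h)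
lemma4p6 lem M T infinite (suc k) _ =
  let h , ρh = ρ-exists infinite in h , ρh , λ h' ρh' → ρ-unique ρh' ρh
  where open MSOFin.Period lem M T k
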